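{- The permutation statistic $(a-cb)+(b-ac)+(c-ba)+[b-a)$ is Mahonian; that is, for every $n\ge1$ and every integer $k$, the number of $\pi\in\mathfrak S_n$ with $((a-cb)+(b-ac)+(c-ba)+[b-a))\,\pi=k$ equals the number of $\pi\in\mathfrak S_n$ with $\mathrm{inv}\,\pi=k$.
   Context: $\mathfrak S_n$ is the set of permutations $\pi=\pi_1\cdots\pi_n$ of $\{1,\dots,n\}$; $\mathrm{inv}\,\pi=\#\{(i,j):1\le i<j\le n,\ \pi_i>\pi_j\}$. Vincular patterns are words over letters $a<b<c$ possibly containing dashes and a leading "[" or trailing "]". An occurrence of a pattern $p=p_1\cdots p_k$ (letters, ignoring dashes and brackets) in $\pi$ is a sequence of positions $i_1<\dots<i_k$ such that $\pi_{i_1}\cdots\pi_{i_k}$ is order-isomorphic to $p_1\cdots p_k$, with $i_{r+1}=i_r+1$ whenever the $r$-th and $(r+1)$-st letters are not separated by a dash, $i_1=1$ if the pattern begins with "[", and $i_k=n$ if it ends with "]". $(\sigma+\tau+\cdots)\,\pi$ is the total number of occurrences of the listed patterns. E.g. $(b-ac)\,\pi=\#\{(i,j):i<j<n,\ \pi_j<\pi_i<\pi_{j+1}\}$ and $[b-a)\,\pi=\#\{j>1:\pi_j<\pi_1\}=\pi_1-1$. -}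

module Defs where

open import Data.Nat using (ℕ; zero; suc; _+_; _<ᵇ_; _≡ᵇ_)
open import Data.Bool using (Bool; true; false; _∧_; not; if_then_else_)
open import Data.Fin using (Fin; toℕ)
open import Data.Vec using (Vec; []; _∷_; lookup)
open import Data.List using (List; []; _∷_; map; concatMap; filter; length; allFin)
open import Data.Nat.ListAction using (sum)

-- A word π = π_1 ⋯ π_n of length n over the alphabet Fin n
-- (entry value v ∈ {0..n-1} stands for the letter v+1; positions are 0-based).
Word : ℕ → Set
Word n = Vec (Fin n) n

allVecs : (n m : ℕ) → List (Vec (Fin m) n)
allVecs zero    m = [] ∷ []
allVecs (suc n) m = concatMap (λ x → map (x ∷_) (allVecs n m)) (allFin m)

ind : Bool → ℕ
ind b = if b then 1 else 0

count1 : ∀ {n} → (Fin n → Bool) → ℕ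
count1 {n} P = sum (map (λ i → ind (P i)) (allFin n))

count2 : ∀ {n} → (Fin n → Fin n → Bool) → ℕ
count2 {n} P = sum (map (λ i → count1 (P i)) (allFin n))

count3 : ∀ {n} → (Fin n → Fin n → Fin n → Bool) → ℕ
count3 {n} P = sum (map (λ i → count2 (P i)) (allFin n))

val : ∀ {n} → Word n → Fin n → ℕ
val π i = toℕ (lookup π i)

isPerm : ∀ {n} → Word n → Bool
isPerm π = count2 (λ i j → (toℕ i <ᵇ toℕ j) ∧ (val π i ≡ᵇ val π j)) ≡ᵇ 0

Sym : (n : ℕ) → List (Word n)
Sym n = filter (λ π → Data.Bool.T? (isPerm π)) (allVecs n n)
  where import Data.Bool

inv : ∀ {n} → Word n → ℕ
inv π = count2 (λ i j → (toℕ i <ᵇ toℕ j) ∧ (val π j <ᵇ val π i))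

-- occurrences of a vincular pattern x-yz: positions i < j, j' = j+1,
-- with (π_i, π_j, π_{j+1}) order-isomorphic to the letters of the pattern,
-- specified by a Boolean test on the three values
occ-x-yz : ∀ {n} → (ℕ → ℕ → ℕ → Bool) → Word n → ℕ
occ-x-yz R π = count3 (λ i j j' → (toℕ i <ᵇ toℕ j) ∧ (toℕ j' ≡ᵇ suc (toℕ j))
                                   ∧ R (val π i) (val π j) (val π j'))

a-cb : ∀ {n} → Word n → ℕ
a-cb = occ-x-yz (λ x y z → (x <ᵇ z) ∧ (z <ᵇ y))

b-ac : ∀ {n} → Word n → ℕ
b-ac = occ-x-yz (λ x y z → (y <ᵇ x) ∧ (x <ᵇ z))

c-ba : ∀ {n} → Word n → ℕ
c-ba = occ-x-yz (λ x y z → (z <ᵇ y) ∧ (y <ᵇ x))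

first-b-a : ∀ {n} → Word n → ℕ
first-b-a π = count2 (λ i j → (toℕ i ≡ᵇ 0) ∧ (toℕ i <ᵇ toℕ j) ∧ (val π j <ᵇ val π i))

stat : ∀ {n} → Word n → ℕ
stat π = a-cb π + b-ac π + c-ba π + first-b-a π

countSym : (n : ℕ) → (∀ {m} → Word m → ℕ) → ℕ → ℕ
countSym n f k = length (filter (λ π → f π Data.Nat.≟ k) (Sym n))
  where import Data.Nat

-- Both statistics obey the Mahonian recursion: their distribution over 𝔖 (n + 1) is the distribution
-- over 𝔖 n spread out by adding 0, 1, …, n. For inv this comes from removing the first letter b, which
-- takes part in exactly b − 1 inversions. For stat, shifting all values cyclically by one (mod n) maps
-- the patterns a-cb, b-ac, c-ba to one another, so their total count cyc is invariant under such
-- rotations, while [b-a) contributes π₁ − 1. Every π ∈ 𝔖 (n + 1) is a unique rotation of τ·(n + 1) with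
-- τ ∈ 𝔖 n; appending the maximum creates n − τₙ new occurrences of b-ac, and as the rotation varies π₁ − 1
-- runs through 0, …, n. Finally cyc(τ) + n − τₙ and stat τ are equidistributed on 𝔖 n, because the
-- rotation sending τ₁ − 1 to n − τₙ is an involution of 𝔖 n carrying one statistic to the other.

module Submission where

open import Defs
open import Data.Bool using (Bool; true; false; _∧_; T; T?)
open import Data.Bool.Properties using (T-∧; T-≡; ∧-zeroʳ; ∧-identityʳ)
open import Data.Empty using (⊥-elim)
open import Data.Fin as F using (Fin; toℕ; punchIn; punchOut; inject₁; fromℕ; lower₁)
import Data.Fin.Properties as FP
open import Data.Fin.Relation.Unary.Top using (view; ‵fromℕ; ‵inject₁)
open import Data.List as L using (List; []; _∷_; map; concatMap; filter; length; allFin; cartesianProductWith)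
import Data.List.Properties as LP
open import Data.List.Membership.Propositional using (_∈_)
import Data.List.Membership.Propositional.Properties as MP
open import Data.List.Relation.Binary.BagAndSetEquality using (∼bag⇒↭; ↭⇒∼bag; >>=-cong)
open import Data.List.Membership.Propositional.Properties.WithK using (unique∧set⇒bag)
open import Data.List.Relation.Binary.Permutation.Propositional
  using (_↭_; ↭-refl; ↭-trans; module PermutationReasoning)
import Data.List.Relation.Binary.Permutation.Propositional.Properties as ↭
import Data.List.Relation.Unary.All as All
import Data.List.Relation.Unary.AllPairs as AllPairs
open import Data.List.Relation.Unary.Any using (here; there)
open import Data.List.Relation.Unary.Unique.Propositional using (Unique)
import Data.List.Relation.Unary.Unique.Propositional.Properties as Unique
open import Data.Nat
  using (ℕ; zero; suc; _+_; _*_; _∸_; _≤_; _<_; _≥_; z≤n; s≤s; s≤s⁻¹; _<ᵇ_; _≡ᵇ_; _≟_)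
open import Data.Nat.DivMod
  using (_%_; _mod_; m<n⇒m%n≡m; n%n≡0; %-distribˡ-+; m%n%n≡m%n; m%n<n; [m+n]%n≡m%n; [m+kn]%n≡m%n)
open import Data.Nat.Properties
open import Data.Nat.Solver using (module +-*-Solver)
open import Algebra.Properties.CommutativeSemigroup +-commutativeSemigroup using (x∙yz≈y∙xz)
open import Data.Nat.ListAction using (sum)
open import Data.Nat.ListAction.Properties using (sum-↭)
open import Data.Product using (∃; ∃₂; _×_; _,_; proj₂)
open import Data.Sum using (_⊎_; inj₁; inj₂)
open import Data.Vec as V using (Vec; []; _∷_; lookup; tabulate)
import Data.Vec.Properties as VP
open import Algebra.Properties.CommutativeMonoid.Sum +-0-commutativeMonoid
  using (sum-syntax; sum-cong-≗; ∑-distrib-+; sum-init-last) renaming (sum to ∑)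
open import Function using (_∘_; id; _⇔_; mk⇔; Equivalence)
open import Function.Definitions using (Injective)
open import Relation.Binary.Definitions using (tri<; tri≈; tri>)
open import Relation.Binary.PropositionalEquality
open import Relation.Nullary using (¬_; yes; no)

ind≡0⇒¬T : ∀ {b} → ind b ≡ 0 → ¬ T b
ind≡0⇒¬T {true} () _

¬T⇒ind≡0 : ∀ {b} → ¬ T b → ind b ≡ 0
¬T⇒ind≡0 {true}  ¬t = ⊥-elim (¬t _)
¬T⇒ind≡0 {false} _  = refl

<ᵇ-true : ∀ {a b} → a < b → (a <ᵇ b) ≡ true
<ᵇ-true {a} {b} a<b = Equivalence.to (T-≡ {a <ᵇ b}) (<⇒<ᵇ a<b)

<ᵇ-false : ∀ {a b} → b ≤ a → (a <ᵇ b) ≡ false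
<ᵇ-false {a} {b} b≤a with a <ᵇ b in eq
... | false = refl
... | true  = ⊥-elim (<⇒≱ (<ᵇ⇒< a b (Equivalence.from T-≡ eq)) b≤a)

<ᵇ-irrefl : ∀ a → (a <ᵇ a) ≡ false
<ᵇ-irrefl a = <ᵇ-false (≤-refl {a})

<ᵇ-asym : ∀ a b → ((a <ᵇ b) ∧ (b <ᵇ a)) ≡ false
<ᵇ-asym a b with a <ᵇ b in eq
... | false = refl
... | true  = <ᵇ-false (<⇒≤ (<ᵇ⇒< a b (Equivalence.from T-≡ eq)))

≡ᵇ-false : ∀ {a b} → a ≢ b → (a ≡ᵇ b) ≡ false
≡ᵇ-false {a} {b} a≢b with a ≡ᵇ b in eq
... | false = refl
... | true  = ⊥-elim (a≢b (≡ᵇ⇒≡ a b (Equivalence.from T-≡ eq)))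

≡ᵇ-refl : ∀ a → (a ≡ᵇ a) ≡ true
≡ᵇ-refl a = Equivalence.to T-≡ (≡⇒≡ᵇ a a refl)

ind-∧-factor : ∀ a b r₁ r₂ r₃ → ind (a ∧ (b ∧ r₁)) + ind (a ∧ (b ∧ r₂)) + ind (a ∧ (b ∧ r₃)) ≡
                                 ind (a ∧ b) * (ind r₁ + ind r₂ + ind r₃)
ind-∧-factor false b     r₁ r₂ r₃ = refl
ind-∧-factor true  false r₁ r₂ r₃ = refl
ind-∧-factor true  true  r₁ r₂ r₃ = sym (+-identityʳ _)

sum-tabulate : ∀ {n} (f : Fin n → ℕ) → sum (L.tabulate f) ≡ ∑ f
sum-tabulate {zero}  f = refl
sum-tabulate {suc n} f = cong (f F.zero +_) (sum-tabulate (f ∘ F.suc))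

sum-map-allFin : ∀ {n} (f : Fin n → ℕ) → sum (map f (allFin n)) ≡ ∑ f
sum-map-allFin f = trans (cong sum (LP.map-tabulate id f)) (sum-tabulate f)

count1-∑ : ∀ {n} (P : Fin n → Bool) → count1 P ≡ ∑[ i < n ] ind (P i)
count1-∑ P = sum-map-allFin (ind ∘ P)

count2-∑ : ∀ {n} (P : Fin n → Fin n → Bool) → count2 P ≡ ∑[ i < n ] ∑[ j < n ] ind (P i j)
count2-∑ {n} P = trans (sum-map-allFin {n} _) (sum-cong-≗ {n} (λ i → count1-∑ (P i)))

count3-∑ : ∀ {n} (P : Fin n → Fin n → Fin n → Bool) →
           count3 P ≡ ∑[ i < n ] ∑[ j < n ] ∑[ k < n ] ind (P i j k)
count3-∑ {n} P = trans (sum-map-allFin {n} _) (sum-cong-≗ {n} (λ i → count2-∑ (P i)))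

∑-zero : ∀ {n} {f : Fin n → ℕ} → (∀ i → f i ≡ 0) → ∑ f ≡ 0
∑-zero {zero}  f≡0 = refl
∑-zero {suc n} f≡0 = cong₂ _+_ (f≡0 F.zero) (∑-zero (f≡0 ∘ F.suc))

∑-zero⁻ : ∀ {n} {f : Fin n → ℕ} → ∑ f ≡ 0 → ∀ i → f i ≡ 0
∑-zero⁻ {f = f} ∑f≡0 F.zero    = m+n≡0⇒m≡0 (f F.zero) ∑f≡0
∑-zero⁻ {f = f} ∑f≡0 (F.suc i) = ∑-zero⁻ (m+n≡0⇒n≡0 (f F.zero) ∑f≡0) i

∑-one : ∀ n → ∑[ i < n ] 1 ≡ n
∑-one zero    = refl
∑-one (suc n) = cong suc (∑-one n)

count-below : ∀ {n b} → b ≤ n → ∑[ u < n ] ind (toℕ u <ᵇ b) ≡ b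
count-below {zero}  z≤n       = refl
count-below {suc n} z≤n       = ∑-zero {suc n} {λ u → ind (toℕ u <ᵇ 0)} (λ _ → refl)
count-below {suc n} (s≤s b≤n) = cong suc (count-below b≤n)

count-above : ∀ {n b} → b < n → ∑[ u < n ] ind (b <ᵇ toℕ u) ≡ n ∸ suc b
count-above {suc n} {zero}  _         = ∑-one n
count-above {suc n} {suc b} (s≤s b<n) = count-above b<n

injective⇒surjective : ∀ {n} {τ : Fin n → Fin n} → Injective _≡_ _≡_ τ → ∀ u → ∃ λ i → τ i ≡ u
injective⇒surjective {suc n} {τ} τ-inj u with FP.any? (λ i → τ i FP.≟ u)
... | yes hit = hit
... | no miss = ⊥-elim (<-irrefl refl (FP.injective⇒≤ avoid-u-injective))
  where
  u≢τ : ∀ i → u ≢ τ i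
  u≢τ i u≡τi = miss (i , sym u≡τi)
  avoid-u : Fin (suc n) → Fin n
  avoid-u i = punchOut (u≢τ i)
  avoid-u-injective : Injective _≡_ _≡_ avoid-u
  avoid-u-injective {i} {j} = τ-inj ∘ FP.punchOut-injective (u≢τ i) (u≢τ j)

map-allFin-↭ : ∀ {n} {τ : Fin n → Fin n} → Injective _≡_ _≡_ τ → map τ (allFin n) ↭ allFin n
map-allFin-↭ {n} {τ} τ-inj = ∼bag⇒↭ (unique∧set⇒bag
  (Unique.map⁺ τ-inj (Unique.allFin⁺ n)) (Unique.allFin⁺ n)
  (λ {u} → mk⇔ (λ _ → MP.∈-allFin u) (λ _ → hit (injective⇒surjective τ-inj u))))
  where
  hit : ∀ {u} → ∃ (λ i → τ i ≡ u) → u ∈ map τ (allFin n)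
  hit (i , refl) = MP.∈-map⁺ τ (MP.∈-allFin i)

∑-reindex : ∀ {n} {τ : Fin n → Fin n} → Injective _≡_ _≡_ τ →
            (f : Fin n → ℕ) → ∑ (f ∘ τ) ≡ ∑ f
∑-reindex {n} {τ} τ-inj f = begin
  ∑ (f ∘ τ)                     ≡⟨ sum-map-allFin (f ∘ τ) ⟨
  sum (map (f ∘ τ) (allFin n))  ≡⟨ cong sum (LP.map-∘ (allFin n)) ⟩
  sum (map f (map τ (allFin n))) ≡⟨ sum-↭ (↭.map⁺ f (map-allFin-↭ τ-inj)) ⟩
  sum (map f (allFin n))        ≡⟨ sum-map-allFin f ⟩
  ∑ f                           ∎
  where open ≡-Reasoning

∑³ : ∀ {n} → (Fin n → Fin n → Fin n → ℕ) → ℕ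
∑³ {n} F = ∑[ i < n ] ∑[ j < n ] ∑[ k < n ] F i j k

∑³-cong : ∀ {n} {F G : Fin n → Fin n → Fin n → ℕ} →
          (∀ i j k → F i j k ≡ G i j k) → ∑³ F ≡ ∑³ G
∑³-cong {n} F≡G = sum-cong-≗ {n} (λ i → sum-cong-≗ {n} (λ j → sum-cong-≗ {n} (F≡G i j)))

∑³-distrib-+ : ∀ {n} (F G : Fin n → Fin n → Fin n → ℕ) →
               ∑³ (λ i j k → F i j k + G i j k) ≡ ∑³ F + ∑³ G
∑³-distrib-+ {n} F G = trans
  (sum-cong-≗ {n} (λ i → trans (sum-cong-≗ {n} (λ j → ∑-distrib-+ (F i j) (G i j)))
                               (∑-distrib-+ (λ j → ∑ (F i j)) (λ j → ∑ (G i j)))))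
  (∑-distrib-+ (λ i → ∑[ j < n ] ∑ (F i j)) (λ i → ∑[ j < n ] ∑ (G i j)))

-- Permutations

IsPermutation : ∀ {n} → Word n → Set
IsPermutation π = Injective _≡_ _≡_ (lookup π)

val-injective : ∀ {n} {π π′ : Word n} → (∀ i → val π i ≡ val π′ i) → π ≡ π′
val-injective {π = π} {π′} eq = begin
  π                        ≡⟨ VP.tabulate∘lookup π ⟨
  tabulate (lookup π)      ≡⟨ VP.tabulate-cong (FP.toℕ-injective ∘ eq) ⟩
  tabulate (lookup π′)     ≡⟨ VP.tabulate∘lookup π′ ⟩
  π′                       ∎
  where open ≡-Reasoning

val<n : ∀ {n} (π : Word n) i → val π i < n
val<n π i = FP.toℕ<n (lookup π i)

repeated : ∀ {n} → Word n → Fin n → Fin n → Bool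
repeated π i j = (toℕ i <ᵇ toℕ j) ∧ (val π i ≡ᵇ val π j)

repeats : ∀ {n} → Word n → ℕ
repeats {n} π = ∑[ i < n ] ∑[ j < n ] ind (repeated π i j)

isPerm⇔no-repeats : ∀ {n} {π : Word n} → T (isPerm π) ⇔ repeats π ≡ 0
isPerm⇔no-repeats {π = π} = mk⇔
  (λ t → trans (sym (count2-∑ (repeated π))) (≡ᵇ⇒≡ _ 0 t))
  (λ r → ≡⇒≡ᵇ _ 0 (trans (count2-∑ (repeated π)) r))

no-repeats⇒distinct : ∀ {n} {π : Word n} → repeats π ≡ 0 →
                      ∀ {i j} → toℕ i < toℕ j → val π i ≢ val π j
no-repeats⇒distinct none {i} {j} i<j πi≡πj =
  ind≡0⇒¬T (∑-zero⁻ (∑-zero⁻ none i) j) (Equivalence.from T-∧ (<⇒<ᵇ i<j , ≡⇒≡ᵇ _ _ πi≡πj))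

distinct⇒IsPermutation : ∀ {n} {π : Word n} →
  (∀ {i j} → toℕ i < toℕ j → val π i ≢ val π j) → IsPermutation π
distinct⇒IsPermutation distinct {i} {j} πi≡πj with <-cmp (toℕ i) (toℕ j)
... | tri< i<j _ _ = ⊥-elim (distinct i<j (cong toℕ πi≡πj))
... | tri≈ _ i≡j _ = FP.toℕ-injective i≡j
... | tri> _ _ j<i = ⊥-elim (distinct j<i (cong toℕ (sym πi≡πj)))

isPerm⇒IsPermutation : ∀ {n} {π : Word n} → T (isPerm π) → IsPermutation π
isPerm⇒IsPermutation {π = π} =
  distinct⇒IsPermutation {π = π} ∘ no-repeats⇒distinct {π = π} ∘
  Equivalence.to (isPerm⇔no-repeats {π = π})

IsPermutation⇒isPerm : ∀ {n} {π : Word n} → IsPermutation π → T (isPerm π)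
IsPermutation⇒isPerm {n} {π} π-inj = Equivalence.from (isPerm⇔no-repeats {π = π})
  (∑-zero {n} (λ i → ∑-zero {n} (λ j → ¬T⇒ind≡0 (λ t →
    let i<j , πi≡πj = Equivalence.to T-∧ t
    in <-irrefl (cong toℕ (π-inj (FP.toℕ-injective (≡ᵇ⇒≡ _ _ πi≡πj)))) (<ᵇ⇒< _ _ i<j)))))

count-values-below : ∀ {n} {π : Word n} → IsPermutation π →
                     ∀ {b} → b ≤ n → ∑[ j < n ] ind (val π j <ᵇ b) ≡ b
count-values-below {π = π} π-perm {b} b≤n =
  trans (∑-reindex π-perm (λ u → ind (toℕ u <ᵇ b))) (count-below b≤n)

count-values-above : ∀ {n} {π : Word n} → IsPermutation π →
                     ∀ {b} → b < n → ∑[ j < n ] ind (b <ᵇ val π j) ≡ n ∸ suc b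
count-values-above {π = π} π-perm {b} b<n =
  trans (∑-reindex π-perm (λ u → ind (b <ᵇ toℕ u))) (count-above b<n)

allVecs-cartesian : ∀ n m → allVecs (suc n) m ≡ cartesianProductWith _∷_ (allFin m) (allVecs n m)
allVecs-cartesian n m = go (allFin m)
  where
  go : ∀ xs → concatMap (λ x → map (x ∷_) (allVecs n m)) xs ≡ cartesianProductWith _∷_ xs (allVecs n m)
  go []       = refl
  go (x ∷ xs) = cong (map (x ∷_) (allVecs n m) L.++_) (go xs)

allVecs-unique : ∀ n m → Unique (allVecs n m)
allVecs-unique zero    m = All.[] AllPairs.∷ AllPairs.[]
allVecs-unique (suc n) m rewrite allVecs-cartesian n m =
  Unique.cartesianProductWith⁺ _∷_ VP.∷-injective (Unique.allFin⁺ m) (allVecs-unique n m)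

∈-allVecs : ∀ {n m} (v : Vec (Fin m) n) → v ∈ allVecs n m
∈-allVecs []      = here refl
∈-allVecs {suc n} {m} (x ∷ v) rewrite allVecs-cartesian n m =
  MP.∈-cartesianProductWith⁺ _∷_ (MP.∈-allFin x) (∈-allVecs v)

Sym-unique : ∀ n → Unique (Sym n)
Sym-unique n = Unique.filter⁺ (T? ∘ isPerm) (allVecs-unique n n)

∈-Sym⁺ : ∀ {n} {π : Word n} → IsPermutation π → π ∈ Sym n
∈-Sym⁺ {π = π} π-perm =
  MP.∈-filter⁺ (T? ∘ isPerm) (∈-allVecs π) (IsPermutation⇒isPerm {π = π} π-perm)

∈-Sym⁻ : ∀ {n} {π : Word n} → π ∈ Sym n → IsPermutation π
∈-Sym⁻ {n} {π} π∈Sym =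
  isPerm⇒IsPermutation {π = π} (proj₂ (MP.∈-filter⁻ (T? ∘ isPerm) {xs = allVecs n n} π∈Sym))

↭-Sym : ∀ {n} {xs : List (Word n)} → Unique xs →
        (∀ {π} → π ∈ xs → IsPermutation π) → (∀ {π} → IsPermutation π → π ∈ xs) → xs ↭ Sym n
↭-Sym {n} xs-unique sound complete = ∼bag⇒↭ (unique∧set⇒bag xs-unique (Sym-unique n)
  (mk⇔ (∈-Sym⁺ ∘ sound) (complete ∘ ∈-Sym⁻)))

count-map : ∀ {A : Set} (f : A → ℕ) k (xs : List A) →
  length (filter (λ x → f x ≟ k) xs) ≡ length (filter (_≟ k) (map f xs))
count-map f k []       = refl
count-map f k (x ∷ xs) with f x ≡ᵇ k
... | true  = cong suc (count-map f k xs)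
... | false = count-map f k xs

countSym-↭ : ∀ n (f g : ∀ {m} → Word m → ℕ) → map f (Sym n) ↭ map g (Sym n) →
             ∀ k → countSym n f k ≡ countSym n g k
countSym-↭ n f g f↭g k = begin
  countSym n f k                              ≡⟨ count-map f k (Sym n) ⟩
  length (filter (_≟ k) (map f (Sym n)))      ≡⟨ ↭.↭-length (↭.filter-↭ (_≟ k) f↭g) ⟩
  length (filter (_≟ k) (map g (Sym n)))      ≡⟨ count-map g k (Sym n) ⟨
  countSym n g k                              ∎
  where open ≡-Reasoning

map-involution-Sym : ∀ {n} (ι : Word n → Word n) → (∀ {π} → IsPermutation π → IsPermutation (ι π)) →
                     (∀ π → ι (ι π) ≡ π) → map ι (Sym n) ↭ Sym n
map-involution-Sym {n} ι ι-perm ι-involutive = ↭-Sym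
  (Unique.map⁺ ι-injective (Sym-unique n)) sound complete
  where
  ι-injective : Injective _≡_ _≡_ ι
  ι-injective {π} {π′} eq = trans (sym (ι-involutive π)) (trans (cong ι eq) (ι-involutive π′))
  sound : ∀ {π} → π ∈ map ι (Sym n) → IsPermutation π
  sound π∈ with MP.∈-map⁻ ι π∈
  ... | σ , σ∈ , refl = ι-perm (∈-Sym⁻ σ∈)
  complete : ∀ {π} → IsPermutation π → π ∈ map ι (Sym n)
  complete {π} π-perm = subst (_∈ map ι (Sym n)) (ι-involutive π) (MP.∈-map⁺ ι (∈-Sym⁺ (ι-perm π-perm)))

-- Building 𝔖 (n + 1) from 𝔖 n

spread : ℕ → List ℕ → List ℕ
spread n xs = concatMap (λ x → map (λ k → x + toℕ k) (allFin (suc n))) xs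

spread-↭ : ∀ n {xs ys} → xs ↭ ys → spread n xs ↭ spread n ys
spread-↭ n xs↭ys = ∼bag⇒↭ (>>=-cong (↭⇒∼bag xs↭ys) (λ _ → ↭⇒∼bag ↭-refl))

concatMap-↭-∈ : ∀ {A B : Set} {f g : A → List B} (xs : List A) →
                (∀ {x} → x ∈ xs → f x ↭ g x) → concatMap f xs ↭ concatMap g xs
concatMap-↭-∈ []       _   = ↭-refl
concatMap-↭-∈ (x ∷ xs) f↭g = ↭.++⁺ (f↭g (here refl)) (concatMap-↭-∈ xs (f↭g ∘ there))

map-cartesianProductWith : ∀ {A B C D : Set} (h : C → D) (g : A → B → C) xs ys →
  map h (cartesianProductWith g xs ys) ≡ concatMap (λ x → map (h ∘ g x) ys) xs
map-cartesianProductWith h g []       ys = refl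
map-cartesianProductWith h g (x ∷ xs) ys = trans (LP.map-++ h (map (g x) ys) _)
  (cong₂ L._++_ (sym (LP.map-∘ ys)) (map-cartesianProductWith h g xs ys))

record Decomposition (n : ℕ) : Set where
  field
    glue            : Word n → Fin (suc n) → Word (suc n)
    glue-injective  : ∀ {σ σ′ k k′} → glue σ k ≡ glue σ′ k′ → σ ≡ σ′ × k ≡ k′
    glue-perm       : ∀ {σ} k → IsPermutation σ → IsPermutation (glue σ k)
    glue-surjective : ∀ {π} → IsPermutation π → ∃₂ λ σ k → IsPermutation σ × glue σ k ≡ π

  glued : List (Word (suc n))
  glued = cartesianProductWith glue (Sym n) (allFin (suc n))

  glued-↭ : glued ↭ Sym (suc n)
  glued-↭ = ↭-Sym (Unique.cartesianProductWith⁺ glue glue-injective (Sym-unique n) (Unique.allFin⁺ (suc n)))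
                  sound complete
    where
    sound : ∀ {π} → π ∈ glued → IsPermutation π
    sound π∈ with MP.∈-cartesianProductWith⁻ glue (Sym n) (allFin (suc n)) π∈
    ... | σ , k , σ∈ , _ , refl = glue-perm k (∈-Sym⁻ σ∈)
    complete : ∀ {π} → IsPermutation π → π ∈ glued
    complete {π} π-perm with glue-surjective {π} π-perm
    ... | σ , k , σ-perm , refl = MP.∈-cartesianProductWith⁺ glue (∈-Sym⁺ σ-perm) (MP.∈-allFin k)

  map-Sym-suc : (f : Word (suc n) → ℕ) (g : Word n → ℕ) {ρ : Word n → Fin (suc n) → Fin (suc n)} →
                (∀ σ → Injective _≡_ _≡_ (ρ σ)) →
                (∀ {σ} k → IsPermutation σ → f (glue σ k) ≡ g σ + toℕ (ρ σ k)) →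
                map f (Sym (suc n)) ↭ spread n (map g (Sym n))
  map-Sym-suc f g {ρ} ρ-inj f∘glue = begin
    map f (Sym (suc n))                                   ↭⟨ ↭.map⁺ f glued-↭ ⟨
    map f glued                                           ≡⟨ map-cartesianProductWith f glue (Sym n) ks ⟩
    concatMap (λ σ → map (f ∘ glue σ) ks) (Sym n)         ↭⟨ concatMap-↭-∈ (Sym n) (reindex ∘ ∈-Sym⁻) ⟩
    concatMap (λ σ → map (λ k → g σ + toℕ k) ks) (Sym n)  ≡⟨ LP.concatMap-map _ g (Sym n) ⟨
    spread n (map g (Sym n))                              ∎
    where
    open PermutationReasoning
    ks = allFin (suc n)
    reindex : ∀ {σ} → IsPermutation σ → map (f ∘ glue σ) ks ↭ map (λ k → g σ + toℕ k) ks
    reindex {σ} σ-perm = begin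
      map (f ∘ glue σ) ks                                ≡⟨ LP.map-cong (λ k → f∘glue k σ-perm) ks ⟩
      map ((λ k → g σ + toℕ k) ∘ ρ σ) ks                 ≡⟨ LP.map-∘ ks ⟩
      map (λ k → g σ + toℕ k) (map (ρ σ) ks)             ↭⟨ ↭.map⁺ _ (map-allFin-↭ (ρ-inj σ)) ⟩
      map (λ k → g σ + toℕ k) ks                         ∎

-- Inversions

prependLetter : ∀ {n} → Word n → Fin (suc n) → Word (suc n)
prependLetter σ b = b ∷ V.map (punchIn b) σ

lookup-prependLetter : ∀ {n} (σ : Word n) b i → lookup (prependLetter σ b) (F.suc i) ≡ punchIn b (lookup σ i)
lookup-prependLetter σ b i = VP.lookup-map i (punchIn b) σ

punchIn-<ᵇ-pivot : ∀ {n} (b : Fin (suc n)) x → (toℕ (punchIn b x) <ᵇ toℕ b) ≡ (toℕ x <ᵇ toℕ b)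
punchIn-<ᵇ-pivot F.zero    x         = refl
punchIn-<ᵇ-pivot (F.suc b) F.zero    = refl
punchIn-<ᵇ-pivot (F.suc b) (F.suc x) = punchIn-<ᵇ-pivot b x

punchIn-<ᵇ : ∀ {n} (b : Fin (suc n)) x y → (toℕ (punchIn b x) <ᵇ toℕ (punchIn b y)) ≡ (toℕ x <ᵇ toℕ y)
punchIn-<ᵇ F.zero    x         y         = refl
punchIn-<ᵇ (F.suc b) F.zero    F.zero    = refl
punchIn-<ᵇ (F.suc b) F.zero    (F.suc y) = refl
punchIn-<ᵇ (F.suc b) (F.suc x) F.zero    = refl
punchIn-<ᵇ (F.suc b) (F.suc x) (F.suc y) = punchIn-<ᵇ b x y

inverted : ∀ {n} → Word n → Fin n → Fin n → Bool
inverted π i j = (toℕ i <ᵇ toℕ j) ∧ (val π j <ᵇ val π i)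

inv-prependLetter : ∀ {n} {σ : Word n} b → IsPermutation σ → inv (prependLetter σ b) ≡ inv σ + toℕ b
inv-prependLetter {n} {σ} b σ-perm = begin
  inv π
    ≡⟨ count2-∑ (inverted π) ⟩
  ∑[ j < n ] ind (val π (F.suc j) <ᵇ toℕ b) + ∑[ i < n ] ∑[ j < n ] ind (inverted π (F.suc i) (F.suc j))
    ≡⟨ cong₂ _+_ first-row (sum-cong-≗ (λ i → sum-cong-≗ (λ j → cong ind (later-rows i j)))) ⟩
  toℕ b + ∑[ i < n ] ∑[ j < n ] ind (inverted σ i j)
    ≡⟨ cong (toℕ b +_) (count2-∑ (inverted σ)) ⟨
  toℕ b + inv σ
    ≡⟨ +-comm (toℕ b) (inv σ) ⟩
  inv σ + toℕ b ∎
  where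
  open ≡-Reasoning
  π = prependLetter σ b
  val-π : ∀ i → val π (F.suc i) ≡ toℕ (punchIn b (lookup σ i))
  val-π i = cong toℕ (lookup-prependLetter σ b i)
  first-row : ∑[ j < n ] ind (val π (F.suc j) <ᵇ toℕ b) ≡ toℕ b
  first-row = begin
    ∑[ j < n ] ind (val π (F.suc j) <ᵇ toℕ b)  ≡⟨ sum-cong-≗ (λ j → cong ind
                                                    (trans (cong (_<ᵇ toℕ b) (val-π j))
                                                      (punchIn-<ᵇ-pivot b (lookup σ j)))) ⟩
    ∑[ j < n ] ind (val σ j <ᵇ toℕ b)          ≡⟨ count-values-below {π = σ} σ-perm (FP.toℕ≤pred[n] b) ⟩
    toℕ b                                      ∎
  later-rows : ∀ i j → inverted π (F.suc i) (F.suc j) ≡ inverted σ i j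
  later-rows i j = cong ((toℕ i <ᵇ toℕ j) ∧_)
    (trans (cong₂ _<ᵇ_ (val-π j) (val-π i)) (punchIn-<ᵇ b (lookup σ j) (lookup σ i)))

prependLetter-injective : ∀ {n} {σ σ′ : Word n} {b b′} →
                          prependLetter σ b ≡ prependLetter σ′ b′ → σ ≡ σ′ × b ≡ b′
prependLetter-injective {σ = σ} {σ′} {b} eq with VP.∷-injective eq
... | refl , _ = val-injective (λ i → cong toℕ (FP.punchIn-injective b _ _ (begin
  punchIn b (lookup σ i)              ≡⟨ lookup-prependLetter σ b i ⟨
  lookup (prependLetter σ b) (F.suc i)  ≡⟨ cong (λ π → lookup π (F.suc i)) eq ⟩
  lookup (prependLetter σ′ b) (F.suc i) ≡⟨ lookup-prependLetter σ′ b i ⟩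
  punchIn b (lookup σ′ i)             ∎))) , refl
  where open ≡-Reasoning

prependLetter-perm : ∀ {n} {σ : Word n} b → IsPermutation σ → IsPermutation (prependLetter σ b)
prependLetter-perm         b σ-perm {F.zero}  {F.zero}  _  = refl
prependLetter-perm {σ = σ} b σ-perm {F.zero}  {F.suc j} eq =
  ⊥-elim (FP.punchInᵢ≢i b (lookup σ j) (sym (trans eq (lookup-prependLetter σ b j))))
prependLetter-perm {σ = σ} b σ-perm {F.suc i} {F.zero}  eq =
  ⊥-elim (FP.punchInᵢ≢i b (lookup σ i) (trans (sym (lookup-prependLetter σ b i)) eq))
prependLetter-perm {σ = σ} b σ-perm {F.suc i} {F.suc j} eq = cong F.suc (σ-perm (FP.punchIn-injective b _ _
  (trans (sym (lookup-prependLetter σ b i)) (trans eq (lookup-prependLetter σ b j)))))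

prependLetter-surjective : ∀ {n} {π : Word (suc n)} → IsPermutation π →
                           ∃₂ λ σ b → IsPermutation σ × prependLetter σ b ≡ π
prependLetter-surjective {n} {π} π-perm = σ , b , σ-perm , val-injective (cong toℕ ∘ same-lookup)
  where
  b = lookup π F.zero
  b≢ : ∀ i → b ≢ lookup π (F.suc i)
  b≢ i eq with π-perm eq
  ... | ()
  σ : Word n
  σ = tabulate (λ i → punchOut (b≢ i))
  lookup-σ : ∀ i → lookup σ i ≡ punchOut (b≢ i)
  lookup-σ = VP.lookup∘tabulate _
  σ-perm : IsPermutation σ
  σ-perm {i} {j} eq = FP.suc-injective (π-perm (FP.punchOut-injective (b≢ i) (b≢ j)
    (trans (sym (lookup-σ i)) (trans eq (lookup-σ j)))))
  same-lookup : ∀ i → lookup (prependLetter σ b) i ≡ lookup π i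
  same-lookup F.zero    = refl
  same-lookup (F.suc i) = trans (lookup-prependLetter σ b i)
    (trans (cong (punchIn b) (lookup-σ i)) (FP.punchIn-punchOut (b≢ i)))

prependDecomposition : ∀ n → Decomposition n
prependDecomposition n = record
  { glue            = prependLetter
  ; glue-injective  = prependLetter-injective
  ; glue-perm       = prependLetter-perm
  ; glue-surjective = prependLetter-surjective
  }

map-inv-Sym-suc : ∀ n → map inv (Sym (suc n)) ↭ spread n (map inv (Sym n))
map-inv-Sym-suc n = Decomposition.map-Sym-suc (prependDecomposition n) inv inv (λ _ → id) inv-prependLetter

-- Cyclic shifts of values

+-suc-comm : ∀ m n → m + suc n ≡ n + suc m
+-suc-comm m n = trans (+-suc m n) (trans (cong suc (+-comm m n)) (sym (+-suc n m)))

shift : ℕ → ℕ → ℕ → ℕ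
shift q c x = (x + c) % suc q

shift-one : ∀ {q x} → x < suc q → (x < q × shift q 1 x ≡ suc x) ⊎ (x ≡ q × shift q 1 x ≡ 0)
shift-one {q} {x} x<1+q with m≤n⇒m<n∨m≡n x<1+q
... | inj₁ 1+x<1+q = inj₁ (s≤s⁻¹ 1+x<1+q , trans (cong (_% suc q) (+-comm x 1)) (m<n⇒m%n≡m 1+x<1+q))
... | inj₂ 1+x≡1+q = inj₂ (suc-injective 1+x≡1+q ,
                           trans (cong (_% suc q) (trans (+-comm x 1) 1+x≡1+q)) (n%n≡0 (suc q)))

shift-shift : ∀ q c d x → shift q d (shift q c x) ≡ shift q (c + d) x
shift-shift q c d x = begin
  ((x + c) % suc q + d) % suc q                 ≡⟨ %-distribˡ-+ ((x + c) % suc q) d (suc q) ⟩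
  ((x + c) % suc q % suc q + d % suc q) % suc q ≡⟨ cong (λ t → (t + d % suc q) % suc q)
                                                         (m%n%n≡m%n (x + c) (suc q)) ⟩
  ((x + c) % suc q + d % suc q) % suc q         ≡⟨ %-distribˡ-+ (x + c) d (suc q) ⟨
  (x + c + d) % suc q                           ≡⟨ cong (_% suc q) (+-assoc x c d) ⟩
  (x + (c + d)) % suc q                         ∎
  where open ≡-Reasoning

shift-multiple : ∀ q k {x} → x < suc q → shift q (k * suc q) x ≡ x
shift-multiple q k {x} x<1+q = trans ([m+kn]%n≡m%n x k (suc q)) (m<n⇒m%n≡m x<1+q)

shift-zero : ∀ q {x} → x < suc q → shift q 0 x ≡ x
shift-zero q = shift-multiple q 0

shift-wrap : ∀ q x c {y} → y < suc q → x + c ≡ y + suc q → shift q c x ≡ y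
shift-wrap q x c {y} y<1+q x+c≡y+1+q =
  trans (cong (_% suc q) x+c≡y+1+q) (trans ([m+n]%n≡m%n y (suc q)) (m<n⇒m%n≡m y<1+q))

shift-injective : ∀ q c {x y} → x < suc q → y < suc q → shift q c x ≡ shift q c y → x ≡ y
shift-injective q c {x} {y} x<1+q y<1+q eq = begin
  x                             ≡⟨ undo x<1+q ⟨
  shift q (c * q) (shift q c x) ≡⟨ cong (shift q (c * q)) eq ⟩
  shift q (c * q) (shift q c y) ≡⟨ undo y<1+q ⟩
  y                             ∎
  where
  open ≡-Reasoning
  undo : ∀ {x} → x < suc q → shift q (c * q) (shift q c x) ≡ x
  undo {x} x<1+q = begin
    shift q (c * q) (shift q c x) ≡⟨ shift-shift q c (c * q) x ⟩
    shift q (c + c * q) x         ≡⟨ cong (λ d → shift q d x) (*-suc c q) ⟨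
    shift q (c * suc q) x         ≡⟨ shift-multiple q c x<1+q ⟩
    x                             ∎

shift<1+q : ∀ q c x → shift q c x < suc q
shift<1+q q c x = m%n<n (x + c) (suc q)

shiftFin : ∀ q → ℕ → Fin (suc q) → Fin (suc q)
shiftFin q c u = (toℕ u + c) mod suc q

toℕ-shiftFin : ∀ q c u → toℕ (shiftFin q c u) ≡ shift q c (toℕ u)
toℕ-shiftFin q c u = FP.toℕ-fromℕ< _

shiftFin-injective : ∀ q c → Injective _≡_ _≡_ (shiftFin q c)
shiftFin-injective q c {u} {u′} eq = FP.toℕ-injective (shift-injective q c (FP.toℕ<n u) (FP.toℕ<n u′)
  (trans (sym (toℕ-shiftFin q c u)) (trans (cong toℕ eq) (toℕ-shiftFin q c u′))))

rotate : ∀ q → ℕ → Word (suc q) → Word (suc q)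
rotate q c π = V.map (shiftFin q c) π

val-rotate : ∀ q c (π : Word (suc q)) i → val (rotate q c π) i ≡ shift q c (val π i)
val-rotate q c π i = trans (cong toℕ (VP.lookup-map i (shiftFin q c) π)) (toℕ-shiftFin q c (lookup π i))

rotate-perm : ∀ q c {π : Word (suc q)} → IsPermutation π → IsPermutation (rotate q c π)
rotate-perm q c {π} π-perm {i} {j} eq = π-perm (shiftFin-injective q c
  (trans (sym (VP.lookup-map i (shiftFin q c) π)) (trans eq (VP.lookup-map j (shiftFin q c) π))))

rotate-rotate : ∀ q c d (π : Word (suc q)) → rotate q d (rotate q c π) ≡ rotate q (c + d) π
rotate-rotate q c d π = val-injective λ i → begin
  val (rotate q d (rotate q c π)) i ≡⟨ val-rotate q d (rotate q c π) i ⟩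
  shift q d (val (rotate q c π) i)  ≡⟨ cong (shift q d) (val-rotate q c π i) ⟩
  shift q d (shift q c (val π i))   ≡⟨ shift-shift q c d (val π i) ⟩
  shift q (c + d) (val π i)         ≡⟨ val-rotate q (c + d) π i ⟨
  val (rotate q (c + d) π) i        ∎
  where open ≡-Reasoning

rotate-multiple : ∀ q k (π : Word (suc q)) → rotate q (k * suc q) π ≡ π
rotate-multiple q k π = val-injective λ i → trans (val-rotate q (k * suc q) π i) (shift-multiple q k (val<n π i))

rotate-injective : ∀ q c {π π′ : Word (suc q)} → rotate q c π ≡ rotate q c π′ → π ≡ π′
rotate-injective q c {π} {π′} eq = val-injective λ i → shift-injective q c (val<n π i) (val<n π′ i) (begin
  shift q c (val π i)       ≡⟨ val-rotate q c π i ⟨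
  val (rotate q c π) i      ≡⟨ cong (λ ρ → val ρ i) eq ⟩
  val (rotate q c π′) i     ≡⟨ val-rotate q c π′ i ⟩
  shift q c (val π′ i)      ∎)
  where open ≡-Reasoning

-- The patterns a-cb, b-ac and c-ba

-- The patterns 132, 213 and 321 of a-cb, b-ac and c-ba are exactly the odd ones, and a cyclic shift
-- of the values changes the pattern of a triple by a 3-cycle, which preserves parity.
cyclicTriple : ℕ → ℕ → ℕ → ℕ
cyclicTriple x y z = ind ((x <ᵇ z) ∧ (z <ᵇ y)) + ind ((y <ᵇ x) ∧ (x <ᵇ z)) + ind ((z <ᵇ y) ∧ (y <ᵇ x))

cyclicTriple-xxz : ∀ x z → cyclicTriple x x z ≡ 0
cyclicTriple-xxz x z rewrite <ᵇ-asym x z | <ᵇ-irrefl x | ∧-zeroʳ (z <ᵇ x) = refl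

cyclicTriple-xyx : ∀ x y → cyclicTriple x y x ≡ 0
cyclicTriple-xyx x y rewrite <ᵇ-irrefl x | <ᵇ-asym x y | ∧-zeroʳ (y <ᵇ x) = refl

cyclicTriple-xyy : ∀ x y → cyclicTriple x y y ≡ 0
cyclicTriple-xyy x y rewrite <ᵇ-irrefl y | <ᵇ-asym y x | ∧-zeroʳ (x <ᵇ y) = refl

cyclicTriple-max₁ : ∀ {x y z} → y < x → z < x → cyclicTriple 0 (suc y) (suc z) ≡ cyclicTriple x y z
cyclicTriple-max₁ {x} {y} {z} y<x z<x rewrite <ᵇ-false {x} {z} (<⇒≤ z<x) | <ᵇ-true y<x with z <ᵇ y
... | true  = refl
... | false = refl

cyclicTriple-max₂ : ∀ {x y z} → x < y → z < y → cyclicTriple (suc x) 0 (suc z) ≡ cyclicTriple x y z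
cyclicTriple-max₂ {x} {y} {z} x<y z<y rewrite <ᵇ-false {y} {x} (<⇒≤ x<y) | <ᵇ-true z<y with x <ᵇ z
... | true  = refl
... | false = refl

cyclicTriple-max₃ : ∀ {x y z} → x < z → y < z → cyclicTriple (suc x) (suc y) 0 ≡ cyclicTriple x y z
cyclicTriple-max₃ {x} {y} {z} x<z y<z rewrite <ᵇ-false {z} {y} (<⇒≤ y<z) | <ᵇ-true x<z with y <ᵇ x
... | true  = refl
... | false = refl

cyclicTriple-max-last : ∀ {x y M} → x < M → y < M → cyclicTriple x y M ≡ ind (y <ᵇ x)
cyclicTriple-max-last {x} {y} {M} x<M y<M
  rewrite <ᵇ-true x<M | <ᵇ-false {M} {y} (<⇒≤ y<M) | ∧-identityʳ (y <ᵇ x) = +-identityʳ _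

cyclicTriple-shift₁ : ∀ {q x y z} → x < suc q → y < suc q → z < suc q →
                      cyclicTriple (shift q 1 x) (shift q 1 y) (shift q 1 z) ≡ cyclicTriple x y z
cyclicTriple-shift₁ {q} {x} {y} {z} x<1+q y<1+q z<1+q with shift-one x<1+q | shift-one y<1+q | shift-one z<1+q
... | inj₁ (_ , ex)      | inj₁ (_ , ey)      | inj₁ (_ , ez)      rewrite ex | ey | ez = refl
... | inj₂ (refl , ex)   | inj₁ (y<q , ey)    | inj₁ (z<q , ez)    rewrite ex | ey | ez = cyclicTriple-max₁ y<q z<q
... | inj₁ (x<q , ex)    | inj₂ (refl , ey)   | inj₁ (z<q , ez)    rewrite ex | ey | ez = cyclicTriple-max₂ x<q z<q
... | inj₁ (x<q , ex)    | inj₁ (y<q , ey)    | inj₂ (refl , ez)   rewrite ex | ey | ez = cyclicTriple-max₃ x<q y<q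
... | inj₂ (refl , ex)   | inj₂ (refl , ey)   | _                  rewrite ex | ey =
  trans (cyclicTriple-xxz 0 (shift q 1 z)) (sym (cyclicTriple-xxz q z))
... | inj₂ (refl , ex)   | _                  | inj₂ (refl , ez)   rewrite ex | ez =
  trans (cyclicTriple-xyx 0 (shift q 1 y)) (sym (cyclicTriple-xyx q y))
... | _                  | inj₂ (refl , ey)   | inj₂ (refl , ez)   rewrite ey | ez =
  trans (cyclicTriple-xyy (shift q 1 x) 0) (sym (cyclicTriple-xyy x q))

cyclicTriple-shift : ∀ q c {x y z} → x < suc q → y < suc q → z < suc q →
                     cyclicTriple (shift q c x) (shift q c y) (shift q c z) ≡ cyclicTriple x y z
cyclicTriple-shift q zero {x} {y} {z} x<1+q y<1+q z<1+q
  rewrite shift-zero q x<1+q | shift-zero q y<1+q | shift-zero q z<1+q = refl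
cyclicTriple-shift q (suc c) {x} {y} {z} x<1+q y<1+q z<1+q
  rewrite +-comm 1 c | sym (shift-shift q c 1 x) | sym (shift-shift q c 1 y) | sym (shift-shift q c 1 z) =
  trans (cyclicTriple-shift₁ (shift<1+q q c x) (shift<1+q q c y) (shift<1+q q c z))
        (cyclicTriple-shift q c x<1+q y<1+q z<1+q)

adjacent : ∀ {n} → Fin n → Fin n → Fin n → Bool
adjacent i j k = (toℕ i <ᵇ toℕ j) ∧ (toℕ k ≡ᵇ suc (toℕ j))

cyclicTerm : ∀ {n} → (Fin n → ℕ) → Fin n → Fin n → Fin n → ℕ
cyclicTerm w i j k = ind (adjacent i j k) * cyclicTriple (w i) (w j) (w k)

cyclicCount : ∀ {n} → (Fin n → ℕ) → ℕ
cyclicCount w = ∑³ (cyclicTerm w)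

cyclicCount-cong : ∀ {n} {w w′ : Fin n → ℕ} → (∀ i → w i ≡ w′ i) → cyclicCount w ≡ cyclicCount w′
cyclicCount-cong {w = w} {w′} w≡w′ = ∑³-cong pointwise
  where
  pointwise : ∀ i j k → cyclicTerm w i j k ≡ cyclicTerm w′ i j k
  pointwise i j k rewrite w≡w′ i | w≡w′ j | w≡w′ k = refl

cyclicCount-shift : ∀ {n} q c {w : Fin n → ℕ} → (∀ i → w i < suc q) →
                    cyclicCount (shift q c ∘ w) ≡ cyclicCount w
cyclicCount-shift q c w<1+q =
  ∑³-cong (λ i j k → cong (ind (adjacent i j k) *_) (cyclicTriple-shift q c (w<1+q i) (w<1+q j) (w<1+q k)))

cyclicCount-rotate : ∀ q c (π : Word (suc q)) → cyclicCount (val (rotate q c π)) ≡ cyclicCount (val π)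
cyclicCount-rotate q c π = trans (cyclicCount-cong (val-rotate q c π)) (cyclicCount-shift q c (val<n π))

stat≡cyclicCount+first-b-a : ∀ {n} (π : Word n) → stat π ≡ cyclicCount (val π) + first-b-a π
stat≡cyclicCount+first-b-a {n} π = cong (_+ first-b-a π) (begin
  a-cb π + b-ac π + c-ba π
    ≡⟨ cong₂ _+_ (cong₂ _+_ (count3-∑ (O R₁)) (count3-∑ (O R₂))) (count3-∑ (O R₃)) ⟩
  ∑³ (ind³ (O R₁)) + ∑³ (ind³ (O R₂)) + ∑³ (ind³ (O R₃))
    ≡⟨ cong (_+ ∑³ (ind³ (O R₃))) (∑³-distrib-+ (ind³ (O R₁)) (ind³ (O R₂))) ⟨
  ∑³ (λ i j k → ind (O R₁ i j k) + ind (O R₂ i j k)) + ∑³ (ind³ (O R₃))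
    ≡⟨ ∑³-distrib-+ (λ i j k → ind (O R₁ i j k) + ind (O R₂ i j k)) (ind³ (O R₃)) ⟨
  ∑³ (λ i j k → ind (O R₁ i j k) + ind (O R₂ i j k) + ind (O R₃ i j k))
    ≡⟨ ∑³-cong (λ i j k → ind-∧-factor (toℕ i <ᵇ toℕ j) (toℕ k ≡ᵇ suc (toℕ j))
                                       (R₁ i j k) (R₂ i j k) (R₃ i j k)) ⟩
  cyclicCount (val π) ∎)
  where
  open ≡-Reasoning
  R₁ R₂ R₃ : Fin n → Fin n → Fin n → Bool
  R₁ i j k = (val π i <ᵇ val π k) ∧ (val π k <ᵇ val π j)
  R₂ i j k = (val π j <ᵇ val π i) ∧ (val π i <ᵇ val π k)
  R₃ i j k = (val π k <ᵇ val π j) ∧ (val π j <ᵇ val π i)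
  O : (Fin n → Fin n → Fin n → Bool) → Fin n → Fin n → Fin n → Bool
  O R i j k = (toℕ i <ᵇ toℕ j) ∧ ((toℕ k ≡ᵇ suc (toℕ j)) ∧ R i j k)
  ind³ : (Fin n → Fin n → Fin n → Bool) → Fin n → Fin n → Fin n → ℕ
  ind³ P i j k = ind (P i j k)

first-b-a-perm : ∀ {n} {π : Word (suc n)} → IsPermutation π → first-b-a π ≡ val π F.zero
first-b-a-perm {n} {π} π-perm = begin
  first-b-a π
    ≡⟨ count2-∑ (λ i j → (toℕ i ≡ᵇ 0) ∧ (toℕ i <ᵇ toℕ j) ∧ (val π j <ᵇ val π i)) ⟩
  later + ∑[ i < n ] ∑[ j < suc n ] 0
    ≡⟨ cong (later +_) (∑-zero {n} (λ _ → ∑-zero {suc n} (λ _ → refl))) ⟩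
  later + 0
    ≡⟨ +-identityʳ later ⟩
  later
    ≡⟨ cong (λ b → ind b + later) (<ᵇ-irrefl v₀) ⟨
  ∑[ j < suc n ] ind (val π j <ᵇ v₀)
    ≡⟨ count-values-below {π = π} π-perm (<⇒≤ (val<n π F.zero)) ⟩
  v₀ ∎
  where
  open ≡-Reasoning
  v₀ = val π F.zero
  later = ∑[ j < n ] ind (val π (F.suc j) <ᵇ v₀)

-- Appending a maximal letter

snoc : ∀ {n} {A : Set} → (Fin n → A) → A → Fin (suc n) → A
snoc {zero}  f a _         = a
snoc {suc n} f a F.zero    = f F.zero
snoc {suc n} f a (F.suc i) = snoc (f ∘ F.suc) a i

snoc-inject₁ : ∀ {n} {A : Set} (f : Fin n → A) a i → snoc f a (inject₁ i) ≡ f i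
snoc-inject₁ f a F.zero    = refl
snoc-inject₁ f a (F.suc i) = snoc-inject₁ (f ∘ F.suc) a i

snoc-fromℕ : ∀ {n} {A : Set} (f : Fin n → A) a → snoc f a (fromℕ n) ≡ a
snoc-fromℕ {zero}  f a = refl
snoc-fromℕ {suc n} f a = snoc-fromℕ (f ∘ F.suc) a

snoc-injective : ∀ {n} {A : Set} {f : Fin n → A} {a} → Injective _≡_ _≡_ f → (∀ i → f i ≢ a) →
                 Injective _≡_ _≡_ (snoc f a)
snoc-injective {f = f} {a} f-inj f≢a {i} {j} eq with view i | view j
... | ‵inject₁ i′ | ‵inject₁ j′ =
  cong inject₁ (f-inj (trans (sym (snoc-inject₁ f a i′)) (trans eq (snoc-inject₁ f a j′))))
... | ‵inject₁ i′ | ‵fromℕ     =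
  ⊥-elim (f≢a i′ (trans (sym (snoc-inject₁ f a i′)) (trans eq (snoc-fromℕ f a))))
... | ‵fromℕ     | ‵inject₁ j′ =
  ⊥-elim (f≢a j′ (trans (sym (snoc-inject₁ f a j′)) (trans (sym eq) (snoc-fromℕ f a))))
... | ‵fromℕ     | ‵fromℕ     = refl

snoc-val< : ∀ {n} (τ : Word n) i → snoc (val τ) n i < suc n
snoc-val< {n} τ i with view i
... | ‵inject₁ j rewrite snoc-inject₁ (val τ) n j = m<n⇒m<1+n (val<n τ j)
... | ‵fromℕ     rewrite snoc-fromℕ (val τ) n    = n<1+n n

cyclicTerm-from-last : ∀ {n} (w : Fin (suc n) → ℕ) j k → cyclicTerm w (fromℕ n) j k ≡ 0
cyclicTerm-from-last {n} w j k rewrite FP.toℕ-fromℕ n | <ᵇ-false {n} (FP.toℕ≤pred[n] j) = refl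

cyclicTerm-through-last : ∀ {n} (w : Fin (suc n) → ℕ) i k → cyclicTerm w i (fromℕ n) k ≡ 0
cyclicTerm-through-last {n} w i k rewrite FP.toℕ-fromℕ n
  | ≡ᵇ-false {toℕ k} {suc n} (<⇒≢ (s≤s (FP.toℕ≤pred[n] k))) | ∧-zeroʳ (toℕ i <ᵇ n) = refl

cyclicTerm-snoc-inject₁ : ∀ {n} (τ : Fin n → ℕ) M i j k →
                          cyclicTerm (snoc τ M) (inject₁ i) (inject₁ j) (inject₁ k) ≡ cyclicTerm τ i j k
cyclicTerm-snoc-inject₁ τ M i j k rewrite FP.toℕ-inject₁ i | FP.toℕ-inject₁ j | FP.toℕ-inject₁ k
  | snoc-inject₁ τ M i | snoc-inject₁ τ M j | snoc-inject₁ τ M k = refl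

cyclicTerm-snoc-last : ∀ {p} (τ : Fin (suc p) → ℕ) {M} → (∀ i → τ i < M) → ∀ i j →
                       cyclicTerm (snoc τ M) (inject₁ i) (inject₁ j) (fromℕ (suc p)) ≡
                       ind ((toℕ i <ᵇ toℕ j) ∧ (p ≡ᵇ toℕ j)) * ind (τ j <ᵇ τ i)
cyclicTerm-snoc-last {p} τ {M} τ<M i j rewrite FP.toℕ-inject₁ i | FP.toℕ-inject₁ j | FP.toℕ-fromℕ p
  | snoc-inject₁ τ M i | snoc-inject₁ τ M j | snoc-fromℕ τ M =
  cong (ind ((toℕ i <ᵇ toℕ j) ∧ (p ≡ᵇ toℕ j)) *_) (cyclicTriple-max-last (τ<M i) (τ<M j))

∑-last-guard : ∀ {p} (τ : Fin (suc p) → ℕ) i →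
               ∑[ j < suc p ] (ind ((toℕ i <ᵇ toℕ j) ∧ (p ≡ᵇ toℕ j)) * ind (τ j <ᵇ τ i)) ≡
               ind (τ (fromℕ p) <ᵇ τ i)
∑-last-guard {p} τ i = begin
  ∑[ j < suc p ] E j
    ≡⟨ sum-init-last E ⟩
  ∑[ j < p ] E (inject₁ j) + E (fromℕ p)
    ≡⟨ cong₂ _+_ (∑-zero {p} earlier-zero) (cong₂ (λ a b → ind ((toℕ i <ᵇ a) ∧ b) * ind (L <ᵇ τ i))
                   (FP.toℕ-fromℕ p) (trans (cong (p ≡ᵇ_) (FP.toℕ-fromℕ p)) (≡ᵇ-refl p))) ⟩
  ind ((toℕ i <ᵇ p) ∧ true) * ind (L <ᵇ τ i)
    ≡⟨ cong (λ b → ind b * ind (L <ᵇ τ i)) (∧-identityʳ (toℕ i <ᵇ p)) ⟩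
  ind (toℕ i <ᵇ p) * ind (L <ᵇ τ i)
    ≡⟨ drop-guard i ⟩
  ind (L <ᵇ τ i) ∎
  where
  open ≡-Reasoning
  L = τ (fromℕ p)
  E : Fin (suc p) → ℕ
  E j = ind ((toℕ i <ᵇ toℕ j) ∧ (p ≡ᵇ toℕ j)) * ind (τ j <ᵇ τ i)
  earlier-zero : ∀ j → E (inject₁ j) ≡ 0
  earlier-zero j = cong (λ b → ind b * ind (τ (inject₁ j) <ᵇ τ i))
    (trans (cong ((toℕ i <ᵇ toℕ (inject₁ j)) ∧_) (≡ᵇ-false (FP.toℕ-inject₁-≢ j))) (∧-zeroʳ _))
  drop-guard : ∀ i → ind (toℕ i <ᵇ p) * ind (L <ᵇ τ i) ≡ ind (L <ᵇ τ i)
  drop-guard i with view i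
  ... | ‵inject₁ j rewrite FP.toℕ-inject₁ j | <ᵇ-true (FP.toℕ<n j) = +-identityʳ _
  ... | ‵fromℕ     rewrite FP.toℕ-fromℕ p | <ᵇ-irrefl p | <ᵇ-irrefl L = refl

cyclicCount-snoc : ∀ {p} (τ : Fin (suc p) → ℕ) {M} → (∀ i → τ i < M) →
                   cyclicCount (snoc τ M) ≡ cyclicCount τ + ∑[ i < suc p ] ind (τ (fromℕ p) <ᵇ τ i)
cyclicCount-snoc {p} τ {M} τ<M = begin
  ∑[ i < suc n ] row i
    ≡⟨ sum-init-last row ⟩
  ∑[ i < n ] row (inject₁ i) + row (fromℕ n)
    ≡⟨ cong₂ _+_ (sum-cong-≗ {n} row-inject₁)
                 (∑-zero {suc n} (λ j → ∑-zero {suc n} (cyclicTerm-from-last w j))) ⟩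
  ∑[ i < n ] ∑[ j < n ] (∑[ k < n ] cyclicTerm τ i j k + E i j) + 0
    ≡⟨ +-identityʳ _ ⟩
  ∑[ i < n ] ∑[ j < n ] (∑[ k < n ] cyclicTerm τ i j k + E i j)
    ≡⟨ sum-cong-≗ {n} (λ i → ∑-distrib-+ (λ j → ∑ (cyclicTerm τ i j)) (E i)) ⟩
  ∑[ i < n ] (∑[ j < n ] ∑[ k < n ] cyclicTerm τ i j k + ∑[ j < n ] E i j)
    ≡⟨ ∑-distrib-+ (λ i → ∑[ j < n ] ∑ (cyclicTerm τ i j)) (λ i → ∑ (E i)) ⟩
  cyclicCount τ + ∑[ i < n ] ∑[ j < n ] E i j
    ≡⟨ cong (cyclicCount τ +_) (sum-cong-≗ {n} (∑-last-guard τ)) ⟩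
  cyclicCount τ + ∑[ i < n ] ind (τ (fromℕ p) <ᵇ τ i) ∎
  where
  open ≡-Reasoning
  n = suc p
  w = snoc τ M
  row : Fin (suc n) → ℕ
  row i = ∑[ j < suc n ] ∑[ k < suc n ] cyclicTerm w i j k
  E : Fin n → Fin n → ℕ
  E i j = ind ((toℕ i <ᵇ toℕ j) ∧ (p ≡ᵇ toℕ j)) * ind (τ j <ᵇ τ i)
  row-inject₁ : ∀ i → row (inject₁ i) ≡ ∑[ j < n ] (∑[ k < n ] cyclicTerm τ i j k + E i j)
  row-inject₁ i = begin
    row (inject₁ i)
      ≡⟨ sum-init-last (λ j → ∑[ k < suc n ] cyclicTerm w (inject₁ i) j k) ⟩
    ∑[ j < n ] ∑[ k < suc n ] cyclicTerm w (inject₁ i) (inject₁ j) k +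
    ∑[ k < suc n ] cyclicTerm w (inject₁ i) (fromℕ n) k
      ≡⟨ cong₂ _+_ (sum-cong-≗ {n} (λ j → trans (sum-init-last (cyclicTerm w (inject₁ i) (inject₁ j)))
                     (cong₂ _+_ (sum-cong-≗ {n} (cyclicTerm-snoc-inject₁ τ M i j))
                                (cyclicTerm-snoc-last τ τ<M i j))))
                   (∑-zero {suc n} (cyclicTerm-through-last w (inject₁ i))) ⟩
    ∑[ j < n ] (∑[ k < n ] cyclicTerm τ i j k + E i j) + 0
      ≡⟨ +-identityʳ _ ⟩
    ∑[ j < n ] (∑[ k < n ] cyclicTerm τ i j k + E i j) ∎

appendMax : ∀ {n} → Word n → Word (suc n)
appendMax {n} τ = tabulate (snoc (inject₁ ∘ lookup τ) (fromℕ n))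

val-appendMax : ∀ {n} (τ : Word n) i → val (appendMax τ) i ≡ snoc (val τ) n i
val-appendMax {n} τ i with view i
... | ‵inject₁ j rewrite VP.lookup∘tabulate (snoc (inject₁ ∘ lookup τ) (fromℕ n)) (inject₁ j)
  | snoc-inject₁ (inject₁ ∘ lookup τ) (fromℕ n) j | snoc-inject₁ (val τ) n j = FP.toℕ-inject₁ (lookup τ j)
... | ‵fromℕ     rewrite VP.lookup∘tabulate (snoc (inject₁ ∘ lookup τ) (fromℕ n)) (fromℕ n)
  | snoc-fromℕ (inject₁ ∘ lookup τ) (fromℕ n) | snoc-fromℕ (val τ) n = FP.toℕ-fromℕ n

val-appendMax-inject₁ : ∀ {n} (τ : Word n) i → val (appendMax τ) (inject₁ i) ≡ val τ i
val-appendMax-inject₁ {n} τ i = trans (val-appendMax τ (inject₁ i)) (snoc-inject₁ (val τ) n i)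

appendMax-perm : ∀ {n} {τ : Word n} → IsPermutation τ → IsPermutation (appendMax τ)
appendMax-perm {n} {τ} τ-perm {i} {j} eq = snoc-injective (τ-perm ∘ FP.inject₁-injective)
  (λ i → FP.fromℕ≢inject₁ ∘ sym)
  (trans (sym (VP.lookup∘tabulate appended i)) (trans eq (VP.lookup∘tabulate appended j)))
  where appended = snoc (inject₁ ∘ lookup τ) (fromℕ n)

appendMax-injective : ∀ {n} {τ τ′ : Word n} → appendMax τ ≡ appendMax τ′ → τ ≡ τ′
appendMax-injective {τ = τ} {τ′} eq = val-injective λ i →
  trans (sym (val-appendMax-inject₁ τ i))
        (trans (cong (λ ρ → val ρ (inject₁ i)) eq) (val-appendMax-inject₁ τ′ i))

rotateAppendMax : ∀ {n} → Word n → Fin (suc n) → Word (suc n)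
rotateAppendMax {n} τ k = rotate n (suc (toℕ k)) (appendMax τ)

val-rotateAppendMax : ∀ {n} (τ : Word n) k i →
                      val (rotateAppendMax τ k) i ≡ shift n (suc (toℕ k)) (snoc (val τ) n i)
val-rotateAppendMax {n} τ k i =
  trans (val-rotate n (suc (toℕ k)) (appendMax τ) i) (cong (shift n (suc (toℕ k))) (val-appendMax τ i))

last-rotateAppendMax : ∀ {n} (τ : Word n) k → val (rotateAppendMax τ k) (fromℕ n) ≡ toℕ k
last-rotateAppendMax {n} τ k = begin
  val (rotateAppendMax τ k) (fromℕ n)          ≡⟨ val-rotateAppendMax τ k (fromℕ n) ⟩
  shift n (suc (toℕ k)) (snoc (val τ) n (fromℕ n)) ≡⟨ cong (shift n (suc (toℕ k))) (snoc-fromℕ (val τ) n) ⟩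
  shift n (suc (toℕ k)) n
    ≡⟨ shift-wrap n n (suc (toℕ k)) (FP.toℕ<n k) (+-suc-comm n (toℕ k)) ⟩
  toℕ k                                        ∎
  where open ≡-Reasoning

rotateAppendMax-injective : ∀ {n} {τ τ′ : Word n} {k k′} →
                            rotateAppendMax τ k ≡ rotateAppendMax τ′ k′ → τ ≡ τ′ × k ≡ k′
rotateAppendMax-injective {n} {τ} {τ′} {k} {k′} eq with FP.toℕ-injective (begin
  toℕ k                                   ≡⟨ last-rotateAppendMax τ k ⟨
  val (rotateAppendMax τ k) (fromℕ n)     ≡⟨ cong (λ ρ → val ρ (fromℕ n)) eq ⟩
  val (rotateAppendMax τ′ k′) (fromℕ n)   ≡⟨ last-rotateAppendMax τ′ k′ ⟩
  toℕ k′                                  ∎)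
  where open ≡-Reasoning
... | refl = appendMax-injective (rotate-injective n (suc (toℕ k)) eq) , refl

rotateAppendMax-perm : ∀ {n} {τ : Word n} k → IsPermutation τ → IsPermutation (rotateAppendMax τ k)
rotateAppendMax-perm {n} {τ} k τ-perm =
  rotate-perm n (suc (toℕ k)) {appendMax τ} (appendMax-perm {τ = τ} τ-perm)

rotateAppendMax-surjective : ∀ {n} {π : Word (suc n)} → IsPermutation π →
                             ∃₂ λ τ k → IsPermutation τ × rotateAppendMax τ k ≡ π
rotateAppendMax-surjective {n} {π} π-perm = τ , k , τ-perm , glued-back
  where
  open ≡-Reasoning
  k = lookup π (fromℕ n)
  L = toℕ k
  L≤n : L ≤ n
  L≤n = FP.toℕ≤pred[n] k
  u = rotate n (n ∸ L) π
  u-perm : IsPermutation u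
  u-perm = rotate-perm n (n ∸ L) {π} π-perm
  u-last : val u (fromℕ n) ≡ n
  u-last = trans (val-rotate n (n ∸ L) π (fromℕ n))
    (trans (cong (_% suc n) (m+[n∸m]≡n L≤n)) (m<n⇒m%n≡m (n<1+n n)))
  n≢u : ∀ i → n ≢ toℕ (lookup u (inject₁ i))
  n≢u i n≡ui = FP.fromℕ≢inject₁ (sym (u-perm (FP.toℕ-injective (trans (sym n≡ui) (sym u-last)))))
  τ : Word n
  τ = tabulate (λ i → lower₁ (lookup u (inject₁ i)) (n≢u i))
  val-τ : ∀ i → val τ i ≡ val u (inject₁ i)
  val-τ i = trans (cong toℕ (VP.lookup∘tabulate _ i)) (FP.toℕ-lower₁ _ (n≢u i))
  τ-perm : IsPermutation τ
  τ-perm {i} {j} eq = FP.inject₁-injective (u-perm (FP.toℕ-injective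
    (trans (sym (val-τ i)) (trans (cong toℕ eq) (val-τ j)))))
  snoc-τ : ∀ i → snoc (val τ) n i ≡ val u i
  snoc-τ i with view i
  ... | ‵inject₁ j = trans (snoc-inject₁ (val τ) n j) (val-τ j)
  ... | ‵fromℕ     = trans (snoc-fromℕ (val τ) n) (sym u-last)
  appendMax-τ : appendMax τ ≡ u
  appendMax-τ = val-injective (λ i → trans (val-appendMax τ i) (snoc-τ i))
  full-turn : n ∸ L + suc L ≡ 1 * suc n
  full-turn = trans (+-suc (n ∸ L) L) (trans (cong suc (m∸n+n≡m L≤n)) (sym (*-identityˡ (suc n))))
  glued-back : rotateAppendMax τ k ≡ π
  glued-back = begin
    rotate n (suc L) (appendMax τ)          ≡⟨ cong (rotate n (suc L)) appendMax-τ ⟩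
    rotate n (suc L) (rotate n (n ∸ L) π)   ≡⟨ rotate-rotate n (n ∸ L) (suc L) π ⟩
    rotate n (n ∸ L + suc L) π              ≡⟨ cong (λ c → rotate n c π) full-turn ⟩
    rotate n (1 * suc n) π                  ≡⟨ rotate-multiple n 1 π ⟩
    π                                       ∎

appendMaxDecomposition : ∀ n → Decomposition n
appendMaxDecomposition n = record
  { glue            = rotateAppendMax
  ; glue-injective  = rotateAppendMax-injective
  ; glue-perm       = λ {σ} k → rotateAppendMax-perm {τ = σ} k
  ; glue-surjective = rotateAppendMax-surjective
  }

-- The statistic

stat′ : ∀ {p} → Word (suc p) → ℕ
stat′ {p} τ = cyclicCount (val τ) + (p ∸ val τ (fromℕ p))

cyclicCount-appendMax : ∀ {p} {τ : Word (suc p)} → IsPermutation τ →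
                        cyclicCount (snoc (val τ) (suc p)) ≡ cyclicCount (val τ) + (p ∸ val τ (fromℕ p))
cyclicCount-appendMax {p} {τ} τ-perm = trans (cyclicCount-snoc (val τ) (val<n τ))
  (cong (cyclicCount (val τ) +_) (count-values-above {π = τ} τ-perm (val<n τ (fromℕ p))))

stat-rotateAppendMax : ∀ {p} {τ : Word (suc p)} k → IsPermutation τ →
                       stat (rotateAppendMax τ k) ≡ stat′ τ + toℕ (shiftFin (suc p) (suc (val τ F.zero)) k)
stat-rotateAppendMax {p} {τ} k τ-perm = begin
  stat π                                             ≡⟨ stat≡cyclicCount+first-b-a π ⟩
  cyclicCount (val π) + first-b-a π                  ≡⟨ cong₂ _+_ cyclic-part first-part ⟩
  stat′ τ + toℕ (shiftFin n (suc (val τ F.zero)) k)  ∎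
  where
  open ≡-Reasoning
  n = suc p
  π = rotateAppendMax τ k
  cyclic-part : cyclicCount (val π) ≡ stat′ τ
  cyclic-part = begin
    cyclicCount (val π)                                  ≡⟨ cyclicCount-cong (val-rotateAppendMax τ k) ⟩
    cyclicCount (shift n (suc (toℕ k)) ∘ snoc (val τ) n) ≡⟨ cyclicCount-shift n (suc (toℕ k)) (snoc-val< τ) ⟩
    cyclicCount (snoc (val τ) n)                         ≡⟨ cyclicCount-appendMax {τ = τ} τ-perm ⟩
    stat′ τ                                              ∎
  first-part : first-b-a π ≡ toℕ (shiftFin n (suc (val τ F.zero)) k)
  first-part = begin
    first-b-a π                           ≡⟨ first-b-a-perm {π = π} (rotateAppendMax-perm {τ = τ} k τ-perm) ⟩
    val π F.zero                          ≡⟨ val-rotateAppendMax τ k F.zero ⟩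
    (val τ F.zero + suc (toℕ k)) % suc n  ≡⟨ cong (_% suc n) (+-suc-comm (val τ F.zero) (toℕ k)) ⟩
    (toℕ k + suc (val τ F.zero)) % suc n  ≡⟨ toℕ-shiftFin n (suc (val τ F.zero)) k ⟨
    toℕ (shiftFin n (suc (val τ F.zero)) k) ∎

map-stat-Sym-suc : ∀ p → map stat (Sym (suc (suc p))) ↭ spread (suc p) (map stat′ (Sym (suc p)))
map-stat-Sym-suc p = Decomposition.map-Sym-suc (appendMaxDecomposition (suc p)) stat stat′
  (λ σ → shiftFin-injective (suc p) (suc (val σ F.zero))) (λ {σ} k → stat-rotateAppendMax {τ = σ} k)

ψ-amount : ∀ {p} → Word (suc p) → ℕ
ψ-amount {p} τ = (p ∸ val τ (fromℕ p)) + (suc p ∸ val τ F.zero)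

-- ψ sends the first letter F to p − L and the last letter L to p − F, so ψ ∘ ψ rotates by 2 (p + 1).
ψ : ∀ {p} → Word (suc p) → Word (suc p)
ψ {p} τ = rotate p (ψ-amount τ) τ

first-ψ : ∀ {p} (τ : Word (suc p)) → val (ψ τ) F.zero ≡ p ∸ val τ (fromℕ p)
first-ψ {p} τ = trans (val-rotate p (ψ-amount τ) τ F.zero)
  (shift-wrap p F (ψ-amount τ) (s≤s (m∸n≤m p L)) (begin
  F + (A + (suc p ∸ F))   ≡⟨ x∙yz≈y∙xz F A (suc p ∸ F) ⟩
  A + (F + (suc p ∸ F))   ≡⟨ cong (A +_) (m+[n∸m]≡n (<⇒≤ (val<n τ F.zero))) ⟩
  A + suc p               ∎))
  where
  open ≡-Reasoning
  F = val τ F.zero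
  L = val τ (fromℕ p)
  A = p ∸ L

last-ψ : ∀ {p} (τ : Word (suc p)) → val (ψ τ) (fromℕ p) ≡ p ∸ val τ F.zero
last-ψ {p} τ = trans (val-rotate p (ψ-amount τ) τ (fromℕ p))
  (shift-wrap p L (ψ-amount τ) (s≤s (m∸n≤m p F)) (begin
  L + ((p ∸ L) + (suc p ∸ F))   ≡⟨ +-assoc L (p ∸ L) (suc p ∸ F) ⟨
  (L + (p ∸ L)) + (suc p ∸ F)   ≡⟨ cong₂ _+_ (m+[n∸m]≡n L≤p) (+-∸-assoc 1 F≤p) ⟩
  p + suc (p ∸ F)               ≡⟨ +-suc-comm p (p ∸ F) ⟩
  (p ∸ F) + suc p               ∎))
  where
  open ≡-Reasoning
  F = val τ F.zero
  L = val τ (fromℕ p)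
  F≤p : F ≤ p
  F≤p = s≤s⁻¹ (val<n τ F.zero)
  L≤p : L ≤ p
  L≤p = s≤s⁻¹ (val<n τ (fromℕ p))

ψ-involutive : ∀ {p} (τ : Word (suc p)) → ψ (ψ τ) ≡ τ
ψ-involutive {p} τ = begin
  rotate p (ψ-amount (ψ τ)) (rotate p (ψ-amount τ) τ)  ≡⟨ rotate-rotate p (ψ-amount τ) (ψ-amount (ψ τ)) τ ⟩
  rotate p (ψ-amount τ + ψ-amount (ψ τ)) τ            ≡⟨ cong (λ c → rotate p c τ) two-turns ⟩
  rotate p (2 * suc p) τ                              ≡⟨ rotate-multiple p 2 τ ⟩
  τ                                                   ∎
  where
  open ≡-Reasoning
  F = val τ F.zero
  L = val τ (fromℕ p)
  A = p ∸ L
  amount-ψ : ψ-amount (ψ τ) ≡ F + (suc p ∸ A)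
  amount-ψ = cong₂ _+_ (trans (cong (p ∸_) (last-ψ τ)) (m∸[m∸n]≡n (s≤s⁻¹ (val<n τ F.zero))))
                       (cong (suc p ∸_) (first-ψ τ))
  two-turns : ψ-amount τ + ψ-amount (ψ τ) ≡ 2 * suc p
  two-turns = begin
    (A + (suc p ∸ F)) + ψ-amount (ψ τ)   ≡⟨ cong ((A + (suc p ∸ F)) +_) amount-ψ ⟩
    (A + (suc p ∸ F)) + (F + (suc p ∸ A)) ≡⟨ solve 4 (λ a b f c → (a :+ b) :+ (f :+ c) := (b :+ f) :+ (a :+ c))
                                                      refl A (suc p ∸ F) F (suc p ∸ A) ⟩
    ((suc p ∸ F) + F) + (A + (suc p ∸ A)) ≡⟨ cong₂ _+_ (m∸n+n≡m (<⇒≤ (val<n τ F.zero)))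
                                                       (m+[n∸m]≡n (m≤n⇒m≤1+n (m∸n≤m p L))) ⟩
    suc p + suc p                         ≡⟨ cong (suc p +_) (+-identityʳ (suc p)) ⟨
    2 * suc p                             ∎
    where open +-*-Solver

ψ-perm : ∀ {p} {τ : Word (suc p)} → IsPermutation τ → IsPermutation (ψ τ)
ψ-perm {p} {τ} = rotate-perm p (ψ-amount τ) {τ}

stat-ψ : ∀ {p} {τ : Word (suc p)} → IsPermutation τ → stat (ψ τ) ≡ stat′ τ
stat-ψ {p} {τ} τ-perm = begin
  stat (ψ τ)                                    ≡⟨ stat≡cyclicCount+first-b-a (ψ τ) ⟩
  cyclicCount (val (ψ τ)) + first-b-a (ψ τ)     ≡⟨ cong₂ _+_ (cyclicCount-rotate p (ψ-amount τ) τ)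
                                                             (first-b-a-perm {π = ψ τ} (ψ-perm {τ = τ} τ-perm)) ⟩
  cyclicCount (val τ) + val (ψ τ) F.zero        ≡⟨ cong (cyclicCount (val τ) +_) (first-ψ τ) ⟩
  stat′ τ                                       ∎
  where open ≡-Reasoning

map-stat′-↭ : ∀ p → map stat′ (Sym (suc p)) ↭ map stat (Sym (suc p))
map-stat′-↭ p = begin
  map stat′ (Sym (suc p))          ≡⟨ LP.map-cong-local (All.tabulate (λ {τ} τ∈ →
                                         sym (stat-ψ {τ = τ} (∈-Sym⁻ τ∈)))) ⟩
  map (stat ∘ ψ) (Sym (suc p))     ≡⟨ LP.map-∘ (Sym (suc p)) ⟩
  map stat (map ψ (Sym (suc p)))   ↭⟨ ↭.map⁺ stat
                                         (map-involution-Sym ψ (λ {τ} → ψ-perm {τ = τ}) ψ-involutive) ⟩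
  map stat (Sym (suc p))           ∎
  where open PermutationReasoning

map-stat-↭-map-inv : ∀ p → map stat (Sym (suc p)) ↭ map inv (Sym (suc p))
map-stat-↭-map-inv zero    = ↭-refl
map-stat-↭-map-inv (suc p) = begin
  map stat (Sym (suc (suc p)))              ↭⟨ map-stat-Sym-suc p ⟩
  spread (suc p) (map stat′ (Sym (suc p)))  ↭⟨ spread-↭ (suc p) (map-stat′-↭ p) ⟩
  spread (suc p) (map stat (Sym (suc p)))   ↭⟨ spread-↭ (suc p) (map-stat-↭-map-inv p) ⟩
  spread (suc p) (map inv (Sym (suc p)))    ↭⟨ map-inv-Sym-suc (suc p) ⟨
  map inv (Sym (suc (suc p)))               ∎
  where open PermutationReasoning

theorem1 : (n : ℕ) → n ≥ 1 → (k : ℕ) → countSym n stat k ≡ countSym n inv k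
theorem1 (suc p) _ = countSym-↭ (suc p) stat inv (map-stat-↭-map-inv p)
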